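{- Let $p$ be an odd prime and $a\in\mathbf{F}_p^{\ast}$. Then: (i) $h_p(\langle 1,a\rangle)\le 1+(a\bmod p)$; (ii) if $a\bmod p<\sqrt{p}$, then $h_p(\langle 1,a\rangle)=1+(a\bmod p)$; (iii) $h_p(\langle 1,a\rangle)=2$ if and only if $a=1+p\mathbf{Z}$; (iv) $h_p(\langle 1,a\rangle)=3$ if and only if $a=2+p\mathbf{Z}$ or $a=(p+1)/2+p\mathbf{Z}$; (v) $h_p(\langle 1,a\rangle)=p$ if and only if $a=p-1+p\mathbf{Z}$; (vi) if $a=p-b+p\mathbf{Z}$ with $1\le b\le p-1$, then $h_p(\langle 1,a\rangle)\le \frac{p+(b-1)^2}{b}$.
   Context: $\mathbf{F}_p=\mathbf{Z}/p\mathbf{Z}$, $\mathbf{F}_p^{\ast}=\mathbf{F}_p\setminus\{0\}$. $\mathbf{P}^{1}(\mathbf{F}_p)$ is the set of equivalence classes $\langle a_1,a_2\rangle$ of nonzero pairs in $\mathbf{F}_p^2$ under $(a_1,a_2)\sim(ka_1,ka_2)$ for $k\in\mathbf{F}_p^{\ast}$. For $x\in\mathbf{F}_p$, $x \bmod p$ denotes the least nonnegative integer in the class $x$. The height of $\langle a_1,a_2\rangle$ is $h_p(\langle a_1,a_2\rangle)=\min\{(ka_1\bmod p)+(ka_2 \bmod p): k=1,\ldots,p-1\}$; in particular $h_p(\langle 1,a\rangle)=\min\{k+(ka\bmod p):k=1,\ldots,p-1\}$. -}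

module Defs where

open import Data.Nat using (ℕ; zero; suc; _+_; _*_; _∸_; _⊓_; NonZero)
open import Data.Nat.DivMod using (_%_)

-- minimum of f k over k = 1 … n (for n ≥ 1); returns f 1 ⊓ … ⊓ f n
-- (for n = 0 it returns f 0, which is never used below since p ≥ 3)
min-1-to : (ℕ → ℕ) → ℕ → ℕ
min-1-to f zero          = f zero
min-1-to f (suc zero)    = f 1
min-1-to f (suc (suc n)) = min-1-to f (suc n) ⊓ f (suc (suc n))

-- height of ⟨1,a⟩ in P¹(F_p):  h_p(⟨1,a⟩) = min { k + (k a mod p) : k = 1,…,p-1 }
hp1 : (p : ℕ) → .{{NonZero p}} → ℕ → ℕ
hp1 p a = min-1-to (λ k → k + (k * a) % p) (p ∸ 1)

{-# OPTIONS --safe #-}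
-- The height only depends on the residue r = a mod p, and the candidate k = 1 gives
-- h ≤ 1 + r. If r² < p, a candidate with k ≤ r is k + kr ≥ 1 + r with no reduction
-- mod p, and one with k > r is already at least 1 + r. For p prime every k r mod p
-- with 0 < k < p is positive, so a height of 2 or 3 can only be attained at k = 1
-- (forcing r = h − 1) or at k = 2 with 2r ≡ 1 (forcing r = (p+1)/2). For r = p − 1
-- every candidate k + (p − k) equals p. For r = p − b, the candidate q = ⌊p/b⌋
-- satisfies q(p − b) ≡ p − qb = p mod b, whence
-- b h ≤ b(q + p mod b) = p + (b − 1)(p mod b) ≤ p + (b − 1)².
module Submission where

open import Defs
open import Data.Nat using (ℕ; zero; suc; _+_; _*_; _∸_; _≤_; _<_; _⊓_; z≤n; s≤s; s≤s⁻¹; NonZero; _/_; _≤?_; 2+; >-nonZero)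
open import Data.Nat.Properties
open import Data.Nat.DivMod
open import Data.Nat.Divisibility
open import Data.Nat.Primality using (Prime; euclidsLemma)
open import Data.Nat.Solver using (module +-*-Solver)
open import Data.Product using (_×_; _,_; ∃-syntax)
open import Data.Sum using (_⊎_; inj₁; inj₂; [_,_]′)
open import Function.Base using (_∘_)
open import Function.Bundles using (_⇔_; mk⇔; Equivalence)
open import Relation.Nullary using (¬_; yes; no; contradiction)
open import Relation.Binary.PropositionalEquality

open +-*-Solver using (solve; _:+_; _:*_; _:=_; con)

private variable
  f g : ℕ → ℕ
  m n k r : ℕ

min-1-to-≤ : ∀ f {n k} → 1 ≤ k → k ≤ n → min-1-to f n ≤ f k
min-1-to-≤ f {suc zero}    (s≤s z≤n) (s≤s z≤n) = ≤-refl
min-1-to-≤ f {suc (suc n)} 1≤k k≤2+n =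
  [ (λ k<2+n → ≤-trans (m⊓n≤m _ _) (min-1-to-≤ f {suc n} 1≤k (s≤s⁻¹ k<2+n)))
  , (λ k≡2+n → subst (λ k → _ ≤ f k) (sym k≡2+n) (m⊓n≤n _ _))
  ]′ (m≤n⇒m<n∨m≡n k≤2+n)

min-1-to-greatest : ∀ f {n m} → 1 ≤ n → (∀ {k} → 1 ≤ k → k ≤ n → m ≤ f k) → m ≤ min-1-to f n
min-1-to-greatest f {suc zero}    _ bound = bound ≤-refl ≤-refl
min-1-to-greatest f {suc (suc n)} _ bound =
  ⊓-glb (min-1-to-greatest f (s≤s z≤n) (λ 1≤k k≤1+n → bound 1≤k (m≤n⇒m≤1+n k≤1+n)))
        (bound (s≤s z≤n) ≤-refl)

min-1-to-attained : ∀ f {n} → 1 ≤ n → ∃[ k ] 1 ≤ k × k ≤ n × min-1-to f n ≡ f k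
min-1-to-attained f {suc zero}    _ = 1 , ≤-refl , ≤-refl , refl
min-1-to-attained f {suc (suc n)} _
  with min-1-to-attained f {suc n} (s≤s z≤n) | ⊓-sel (min-1-to f (suc n)) (f (suc (suc n)))
... | k , 1≤k , k≤1+n , init≡fk | inj₁ min≡init = k , 1≤k , m≤n⇒m≤1+n k≤1+n , trans min≡init init≡fk
... | _                         | inj₂ min≡last = suc (suc n) , s≤s z≤n , ≤-refl , min≡last

min-1-to-cong : f ≗ g → ∀ n → min-1-to f n ≡ min-1-to g n
min-1-to-cong f≗g zero          = f≗g 0
min-1-to-cong f≗g (suc zero)    = f≗g 1
min-1-to-cong f≗g (suc (suc n)) = cong₂ _⊓_ (min-1-to-cong f≗g (suc n)) (f≗g (suc (suc n)))

m+n≡2⇒m≡1∧n≡1 : 1 ≤ m → 1 ≤ n → m + n ≡ 2 → m ≡ 1 × n ≡ 1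
m+n≡2⇒m≡1∧n≡1 {1}          {1}     _ _ _  = refl , refl
m+n≡2⇒m≡1∧n≡1 {1}          {2+ _}  _ _ ()
m+n≡2⇒m≡1∧n≡1 {2}          {suc _} _ _ ()
m+n≡2⇒m≡1∧n≡1 {suc (2+ _)} {suc _} _ _ ()

m+n≡3⇒m≡1∧n≡2∨m≡2∧n≡1 : 1 ≤ m → 1 ≤ n → m + n ≡ 3 → m ≡ 1 × n ≡ 2 ⊎ m ≡ 2 × n ≡ 1
m+n≡3⇒m≡1∧n≡2∨m≡2∧n≡1 {1}           {2}          _ _ _  = inj₁ (refl , refl)
m+n≡3⇒m≡1∧n≡2∨m≡2∧n≡1 {2}           {1}          _ _ _  = inj₂ (refl , refl)
m+n≡3⇒m≡1∧n≡2∨m≡2∧n≡1 {1}           {suc (2+ _)} _ _ ()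
m+n≡3⇒m≡1∧n≡2∨m≡2∧n≡1 {2}           {2+ _}       _ _ ()
m+n≡3⇒m≡1∧n≡2∨m≡2∧n≡1 {3}           {suc _}      _ _ ()
m+n≡3⇒m≡1∧n≡2∨m≡2∧n≡1 {2+ (2+ _)}   {suc _}      _ _ ()

2∣n+1 : ¬ 2 ∣ n → 2 ∣ n + 1
2∣n+1 {zero}        2∤0   = contradiction (2 ∣0) 2∤0
2∣n+1 {suc zero}    _     = ∣-refl
2∣n+1 {suc (suc n)} 2∤2+n = ∣m∣n⇒∣m+n ∣-refl (2∣n+1 (2∤2+n ∘ ∣m∣n⇒∣m+n ∣-refl))

m≡n/2⇔2*m≡n : 2 ∣ n → m ≡ n / 2 ⇔ 2 * m ≡ n
m≡n/2⇔2*m≡n {n} {m} 2∣n = mk⇔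
  (λ m≡n/2 → trans (cong (2 *_) m≡n/2) (m*[n/m]≡n 2∣n))
  (λ 2m≡n → *-cancelˡ-≡ m (n / 2) 2 (trans 2m≡n (sym (m*[n/m]≡n 2∣n))))

module _ {p : ℕ} .{{_ : NonZero p}} where

  m*n%p≡m*[n%p]%p : ∀ m n → m * n % p ≡ m * (n % p) % p
  m*n%p≡m*[n%p]%p m n = begin
    m * n % p                   ≡⟨ %-distribˡ-* m n p ⟩
    (m % p) * (n % p) % p       ≡⟨ cong (λ x → (m % p) * x % p) (m%n%n≡m%n n p) ⟨
    (m % p) * (n % p % p) % p   ≡⟨ %-distribˡ-* m (n % p) p ⟨
    m * (n % p) % p             ∎
    where open ≡-Reasoning

  m*[p∸n]%p≡[p∸m*n]%p : ∀ m n → m * n ≤ p → m * (p ∸ n) % p ≡ (p ∸ m * n) % p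
  m*[p∸n]%p≡[p∸m*n]%p zero    n _     = trans (m*n%n≡0 0 p) (sym (n%n≡0 p))
  m*[p∸n]%p≡[p∸m*n]%p (suc m) n mn≤p = begin
    suc m * (p ∸ n) % p            ≡⟨ cong (_% p) (*-distribˡ-∸ (suc m) p n) ⟩
    (p + m * p ∸ suc m * n) % p    ≡⟨ cong (_% p) (+-∸-comm (m * p) mn≤p) ⟩
    (p ∸ suc m * n + m * p) % p    ≡⟨ [m+kn]%n≡m%n (p ∸ suc m * n) m p ⟩
    (p ∸ suc m * n) % p            ∎
    where open ≡-Reasoning

  m<p+p⇒m≡m%p∨m≡p+m%p : m < p + p → m ≡ m % p ⊎ m ≡ p + m % p
  m<p+p⇒m≡m%p∨m≡p+m%p {m} m<p+p with p ≤? m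
  ... | no  p≰m = inj₁ (sym (m<n⇒m%n≡m (≰⇒> p≰m)))
  ... | yes p≤m = inj₂ (begin
    m                 ≡⟨ m+[n∸m]≡n p≤m ⟨
    p + (m ∸ p)       ≡⟨ cong (p +_) (m<n⇒m%n≡m (m<n+o⇒m∸n<o m p m<p+p)) ⟨
    p + (m ∸ p) % p   ≡⟨ cong (p +_) (m≤n⇒[n∸m]%m≡n%m p≤m) ⟩
    p + m % p         ∎)
    where open ≡-Reasoning

  hp1-% : ∀ a → hp1 p a ≡ hp1 p (a % p)
  hp1-% a = min-1-to-cong (λ k → cong (k +_) (m*n%p≡m*[n%p]%p k a)) (p ∸ 1)

  hp1-≤ : ∀ a {k} → 1 ≤ k → k < p → hp1 p a ≤ k + k * a % p
  hp1-≤ a 1≤k k<p = min-1-to-≤ _ 1≤k (suc[m]≤n⇒m≤pred[n] k<p)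

  hp1-greatest : ∀ a {m} → 1 < p → (∀ {k} → 1 ≤ k → k < p → m ≤ k + k * a % p) → m ≤ hp1 p a
  hp1-greatest a 1<p bound =
    min-1-to-greatest _ (suc[m]≤n⇒m≤pred[n] 1<p) (λ 1≤k → bound 1≤k ∘ m≤pred[n]⇒suc[m]≤n)

  hp1-attained : ∀ a → 1 < p → ∃[ k ] 1 ≤ k × k < p × hp1 p a ≡ k + k * a % p
  hp1-attained a 1<p with min-1-to-attained (λ k → k + k * a % p) (suc[m]≤n⇒m≤pred[n] 1<p)
  ... | k , 1≤k , k≤p∸1 , h≡ = k , 1≤k , m≤pred[n]⇒suc[m]≤n k≤p∸1 , h≡

  p/n*[p∸n]%p≡p%n : ∀ {n} .{{_ : NonZero n}} → n ≤ p → p / n * (p ∸ n) % p ≡ p % n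
  p/n*[p∸n]%p≡p%n {n} n≤p = begin
    p / n * (p ∸ n) % p   ≡⟨ m*[p∸n]%p≡[p∸m*n]%p (p / n) n (m/n*n≤m p n) ⟩
    (p ∸ p / n * n) % p   ≡⟨ cong (_% p) (m%n≡m∸m/n*n p n) ⟨
    p % n % p             ≡⟨ m<n⇒m%n≡m (<-≤-trans (m%n<n p n) n≤p) ⟩
    p % n                 ∎
    where open ≡-Reasoning

  k+k*[p∸1]%p≡p : 1 ≤ k → k < p → k + k * (p ∸ 1) % p ≡ p
  k+k*[p∸1]%p≡p {k} 1≤k k<p = begin
    k + k * (p ∸ 1) % p   ≡⟨ cong (k +_) (m*[p∸n]%p≡[p∸m*n]%p k 1 k*1≤p) ⟩
    k + (p ∸ k * 1) % p   ≡⟨ cong (λ x → k + (p ∸ x) % p) (*-identityʳ k) ⟩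
    k + (p ∸ k) % p       ≡⟨ cong (k +_) (m<n⇒m%n≡m (∸-monoʳ-< 1≤k (<⇒≤ k<p))) ⟩
    k + (p ∸ k)           ≡⟨ m+[n∸m]≡n (<⇒≤ k<p) ⟩
    p                     ∎
    where
    open ≡-Reasoning
    k*1≤p : k * 1 ≤ p
    k*1≤p = subst (_≤ p) (sym (*-identityʳ k)) (<⇒≤ k<p)

  2*r%p≡1⇒2*r≡p+1 : r < p → 2 * r % p ≡ 1 → 2 * r ≡ p + 1
  2*r%p≡1⇒2*r≡p+1 {r} r<p 2r%p≡1
    with m<p+p⇒m≡m%p∨m≡p+m%p (subst (λ x → r + x < p + p) (sym (+-identityʳ r)) (+-mono-< r<p r<p))
  ... | inj₁ 2r≡2r%p   = contradiction (trans 2r≡2r%p 2r%p≡1) (even≢odd r 0)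
  ... | inj₂ 2r≡p+2r%p = trans 2r≡p+2r%p (cong (p +_) 2r%p≡1)

  1*r%p≡r : r < p → 1 * r % p ≡ r
  1*r%p≡r {r} r<p = trans (cong (_% p) (*-identityˡ r)) (m<n⇒m%n≡m r<p)

  hp1≤1+r : 1 < p → r < p → hp1 p r ≤ 1 + r
  hp1≤1+r {r} 1<p r<p = subst (λ x → hp1 p r ≤ 1 + x) (1*r%p≡r r<p) (hp1-≤ r ≤-refl 1<p)

  b*hp1[p∸b]≤p+[b∸1]*[b∸1] : ∀ {b} → 1 ≤ b → b < p → b * hp1 p (p ∸ b) ≤ p + (b ∸ 1) * (b ∸ 1)
  b*hp1[p∸b]≤p+[b∸1]*[b∸1] {1} _ 1<p = begin
    1 * hp1 p (p ∸ 1)   ≡⟨ *-identityˡ _ ⟩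
    hp1 p (p ∸ 1)       ≤⟨ hp1≤1+r 1<p (∸-monoʳ-< ≤-refl (<⇒≤ 1<p)) ⟩
    1 + (p ∸ 1)         ≡⟨ m+[n∸m]≡n (<⇒≤ 1<p) ⟩
    p                   ≡⟨ +-identityʳ p ⟨
    p + 0               ∎
    where open ≤-Reasoning
  b*hp1[p∸b]≤p+[b∸1]*[b∸1] {b@(suc b′@(suc _))} _ b<p = begin
    b * hp1 p (p ∸ b)      ≤⟨ *-monoʳ-≤ b hp1≤q+s ⟩
    b * (q + s)            ≡⟨ b[q+s]≡s+qb+b′s ⟩
    (s + q * b) + b′ * s   ≡⟨ cong (_+ b′ * s) (m≡m%n+[m/n]*n p b) ⟨
    p + b′ * s             ≤⟨ +-monoʳ-≤ p (*-monoʳ-≤ b′ (s≤s⁻¹ (m%n<n p b))) ⟩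
    p + b′ * b′            ∎
    where
    open ≤-Reasoning
    q s : ℕ
    q = p / b
    s = p % b
    b[q+s]≡s+qb+b′s : b * (q + s) ≡ (s + q * b) + b′ * s
    b[q+s]≡s+qb+b′s =
      solve 3 (λ q s c → (con 1 :+ c) :* (q :+ s) := (s :+ q :* (con 1 :+ c)) :+ c :* s) refl q s b′
    hp1≤q+s : hp1 p (p ∸ b) ≤ q + s
    hp1≤q+s = subst (λ x → hp1 p (p ∸ b) ≤ q + x) (p/n*[p∸n]%p≡p%n (<⇒≤ b<p))
                (hp1-≤ (p ∸ b) (m≥n⇒m/n>0 (<⇒≤ b<p)) (m/n<m p b (s≤s (s≤s z≤n))))

  module _ {r : ℕ} (1≤r : 1 ≤ r) (r<p : r < p) where

    private
      1<p : 1 < p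
      1<p = ≤-<-trans 1≤r r<p

    r*r<p⇒hp1≡1+r : r * r < p → hp1 p r ≡ 1 + r
    r*r<p⇒hp1≡1+r r*r<p = ≤-antisym (hp1≤1+r 1<p r<p) (hp1-greatest r 1<p 1+r≤)
      where
      1+r≤ : 1 ≤ k → k < p → 1 + r ≤ k + k * r % p
      1+r≤ {k} 1≤k k<p with k ≤? r
      ... | no  k≰r = ≤-trans (≰⇒> k≰r) (m≤m+n k _)
      ... | yes k≤r = +-mono-≤ 1≤k (begin
        r           ≤⟨ m≤n*m r k {{>-nonZero 1≤k}} ⟩
        k * r       ≡⟨ m<n⇒m%n≡m (≤-<-trans (*-monoˡ-≤ r k≤r) r*r<p) ⟨
        k * r % p   ∎)
        where open ≤-Reasoning

    hp1≡p⇔r≡p∸1 : hp1 p r ≡ p ⇔ r ≡ p ∸ 1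
    hp1≡p⇔r≡p∸1 = mk⇔ hp1≡p⇒r≡p∸1 r≡p∸1⇒hp1≡p
      where
      hp1≡p⇒r≡p∸1 : hp1 p r ≡ p → r ≡ p ∸ 1
      hp1≡p⇒r≡p∸1 h≡p = ≤-antisym (suc[m]≤n⇒m≤pred[n] r<p)
        (∸-monoˡ-≤ 1 (subst (_≤ 1 + r) h≡p (hp1≤1+r 1<p r<p)))
      r≡p∸1⇒hp1≡p : r ≡ p ∸ 1 → hp1 p r ≡ p
      r≡p∸1⇒hp1≡p refl = ≤-antisym
        (≤-trans (hp1≤1+r 1<p r<p) (≤-reflexive (m+[n∸m]≡n (<⇒≤ 1<p))))
        (hp1-greatest r 1<p (λ 1≤k k<p → ≤-reflexive (sym (k+k*[p∸1]%p≡p 1≤k k<p))))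

    module _ (p-prime : Prime p) where

      1≤k*r%p : 1 ≤ k → k < p → 1 ≤ k * r % p
      1≤k*r%p {k} 1≤k k<p = n≢0⇒n>0 λ k*r%p≡0 →
        [ >⇒∤ {{>-nonZero 1≤k}} k<p , >⇒∤ {{>-nonZero 1≤r}} r<p ]′
        (euclidsLemma k r p-prime (m%n≡0⇒n∣m (k * r) p k*r%p≡0))

      2≤hp1 : 2 ≤ hp1 p r
      2≤hp1 = hp1-greatest r 1<p (λ 1≤k k<p → +-mono-≤ 1≤k (1≤k*r%p 1≤k k<p))

      hp1≡2⇒r≡1 : hp1 p r ≡ 2 → r ≡ 1
      hp1≡2⇒r≡1 h≡2 with hp1-attained r 1<p
      ... | k , 1≤k , k<p , h≡ with m+n≡2⇒m≡1∧n≡1 1≤k (1≤k*r%p 1≤k k<p) (trans (sym h≡) h≡2)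
      ...   | refl , r%p≡1 = trans (sym (1*r%p≡r r<p)) r%p≡1

      hp1≡2⇔r≡1 : hp1 p r ≡ 2 ⇔ r ≡ 1
      hp1≡2⇔r≡1 = mk⇔ hp1≡2⇒r≡1 λ where refl → ≤-antisym (hp1≤1+r 1<p r<p) 2≤hp1

      r≢1⇒3≤hp1 : r ≢ 1 → 3 ≤ hp1 p r
      r≢1⇒3≤hp1 r≢1 = ≤∧≢⇒< 2≤hp1 (r≢1 ∘ hp1≡2⇒r≡1 ∘ sym)

      hp1≡3⇔r≡2∨r≡[p+1]/2 : ¬ 2 ∣ p → hp1 p r ≡ 3 ⇔ (r ≡ 2 ⊎ r ≡ (p + 1) / 2)
      hp1≡3⇔r≡2∨r≡[p+1]/2 2∤p = mk⇔ hp1≡3⇒ ⇒hp1≡3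
        where
        r≡[p+1]/2⇔2r≡p+1 : r ≡ (p + 1) / 2 ⇔ 2 * r ≡ p + 1
        r≡[p+1]/2⇔2r≡p+1 = m≡n/2⇔2*m≡n (2∣n+1 2∤p)

        hp1≡3⇒ : hp1 p r ≡ 3 → r ≡ 2 ⊎ r ≡ (p + 1) / 2
        hp1≡3⇒ h≡3 with hp1-attained r 1<p
        ... | k , 1≤k , k<p , h≡
          with m+n≡3⇒m≡1∧n≡2∨m≡2∧n≡1 1≤k (1≤k*r%p 1≤k k<p) (trans (sym h≡) h≡3)
        ...   | inj₁ (refl , r%p≡2)  = inj₁ (trans (sym (1*r%p≡r r<p)) r%p≡2)
        ...   | inj₂ (refl , 2r%p≡1) =
          inj₂ (Equivalence.from r≡[p+1]/2⇔2r≡p+1 (2*r%p≡1⇒2*r≡p+1 r<p 2r%p≡1))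

        ⇒hp1≡3 : r ≡ 2 ⊎ r ≡ (p + 1) / 2 → hp1 p r ≡ 3
        ⇒hp1≡3 (inj₁ refl)      = ≤-antisym (hp1≤1+r 1<p r<p) (r≢1⇒3≤hp1 λ ())
        ⇒hp1≡3 (inj₂ r≡[p+1]/2) = ≤-antisym hp1≤3 (r≢1⇒3≤hp1 r≢1)
          where
          2r≡p+1 : 2 * r ≡ p + 1
          2r≡p+1 = Equivalence.to r≡[p+1]/2⇔2r≡p+1 r≡[p+1]/2
          r≢1 : r ≢ 1
          r≢1 refl = <⇒≢ (+-monoˡ-< 1 1<p) 2r≡p+1
          2<p : 2 < p
          2<p = ≤∧≢⇒< 1<p (λ 2≡p → 2∤p (subst (2 ∣_) 2≡p ∣-refl))
          2r%p≡1 : 2 * r % p ≡ 1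
          2r%p≡1 = begin
            2 * r % p   ≡⟨ cong (_% p) 2r≡p+1 ⟩
            (p + 1) % p ≡⟨ %-remove-+ˡ 1 ∣-refl ⟩
            1 % p       ≡⟨ m<n⇒m%n≡m 1<p ⟩
            1           ∎
            where open ≡-Reasoning
          hp1≤3 : hp1 p r ≤ 3
          hp1≤3 = subst (λ x → hp1 p r ≤ 2 + x) 2r%p≡1 (hp1-≤ r (s≤s z≤n) 2<p)

lemma3 : (p : ℕ) → .{{_ : NonZero p}} → Prime p → ¬ (2 ∣ p) →
         (a : ℕ) → ¬ (p ∣ a) →
         (hp1 p a ≤ 1 + a % p)
         × ((a % p) * (a % p) < p → hp1 p a ≡ 1 + a % p)
         × (hp1 p a ≡ 2 ⇔ a % p ≡ 1)
         × (hp1 p a ≡ 3 ⇔ (a % p ≡ 2 ⊎ a % p ≡ (p + 1) / 2))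
         × (hp1 p a ≡ p ⇔ a % p ≡ p ∸ 1)
         × ((b : ℕ) → 1 ≤ b → b ≤ p ∸ 1 → a % p ≡ p ∸ b →
            b * hp1 p a ≤ p + (b ∸ 1) * (b ∸ 1))
lemma3 p p-prime 2∤p a p∤a rewrite hp1-% {p} a =
    hp1≤1+r 1<p r<p
  , r*r<p⇒hp1≡1+r 1≤r r<p
  , hp1≡2⇔r≡1 1≤r r<p p-prime
  , hp1≡3⇔r≡2∨r≡[p+1]/2 1≤r r<p p-prime 2∤p
  , hp1≡p⇔r≡p∸1 1≤r r<p
  , λ b 1≤b b≤p∸1 r≡p∸b → subst (λ r → b * hp1 p r ≤ p + (b ∸ 1) * (b ∸ 1)) (sym r≡p∸b)
                            (b*hp1[p∸b]≤p+[b∸1]*[b∸1] 1≤b (m≤pred[n]⇒suc[m]≤n b≤p∸1))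
  where
  r<p : a % p < p
  r<p = m%n<n a p
  1≤r : 1 ≤ a % p
  1≤r = n≢0⇒n>0 (p∤a ∘ m%n≡0⇒n∣m a p)
  1<p : 1 < p
  1<p = ≤-<-trans 1≤r r<p
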